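{- Let $M=(y_{ij})$ be an $m\times r$ integer matrix with columns $y_1,\dots,y_r\in\mathbb{Z}^m$. For integer matrices $A,B$ write $X_A$ for the standardized abelian Cayley graph with Heuberger matrix $A$. Then each of the following maps, defined on the generators $e_i$ (cosets of the standard basis vectors) and extended to group homomorphisms, is a well-defined graph homomorphism: (a) For any integer $a$ and any $j$, if $M^{(a)}$ is obtained from $M$ by multiplying its $j$th column by $a$, then the map $X_{M^{(a)}}\to X_M$ given by $e_i\mapsto e_i$ for all $i$ is a graph homomorphism. (b) If $m\ge 2$ and $N$ is the $(m-1)\times r$ matrix whose first row is the sum of the first two rows of $M$ and whose remaining rows are rows $3,\dots,m$ of $M$, then the map $X_M\to X_N$ given by $e_1,e_2\mapsto e_1$ and $e_i\mapsto e_{i-1}$ for $i\ge 3$ is a graph homomorphism. (c) For any $y_{r+1}\in\mathbb{Z}^m$, the map $X_M\to X_{(y_1\,\cdots\,y_r\,y_{r+1})}$ given by $e_i\mapsto e_i$ for all $i$ is a graph homomorphism. (d) If $\widetilde M$ is the $(m+1)\times r$ matrix obtained by appending a row of zeros to $M$, then the map $X_M\to X_{\widetilde M}$ given by $e_i\mapsto e_i$ for $i=1,\dots,m$ is a graph homomorphism. (e) Every isomorphism arising from permuting columns, multiplying a column by $-1$, adding an integer multiple of one column to another, deleting a column in the $\mathbb{Z}$-span of the others, permuting rows, or multiplying a row by $-1$ is a graph homomorphism, and any composition of the graph homomorphisms above is a graph homomorphism.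
   Context: Given an $m\times r$ integer matrix $M$, let $H$ be the subgroup of $\mathbb{Z}^m$ generated by the columns of $M$, let $e_1,\dots,e_m$ be the standard basis of $\mathbb{Z}^m$ (also used for the cosets $H+e_i$), and $S=\{H\pm e_1,\dots,H\pm e_m\}$. The standardized abelian Cayley graph with Heuberger matrix $M$ is $\mathrm{Cay}(\mathbb{Z}^m/H,S)$ (vertices $\mathbb{Z}^m/H$, $x\sim y$ iff $x-y\in S$; loops allowed, no multiple edges). A graph homomorphism is a map of vertex sets sending adjacent vertices to adjacent vertices. -}

module Defs where

open import Data.Nat using (ℕ; zero; suc)
open import Data.Integer using (ℤ; _+_; _*_; -_; _-_; 0ℤ; 1ℤ)
open import Data.Fin using (Fin; zero; suc; inject₁; punchIn; _≟_)
open import Data.Fin.Permutation using (Permutation′; _⟨$⟩ʳ_; _⟨$⟩ˡ_)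
open import Data.Product using (Σ; ∃; ∃-syntax; _×_; _,_)
open import Data.Sum using (_⊎_)
open import Relation.Binary.PropositionalEquality using (_≡_; _≢_)
open import Relation.Nullary using (yes; no)

Vecℤ : ℕ → Set
Vecℤ m = Fin m → ℤ

-- m × r integer matrix: M i j = entry in row i, column j
Mat : ℕ → ℕ → Set
Mat m r = Fin m → Fin r → ℤ

sumFin : ∀ {r} → (Fin r → ℤ) → ℤ
sumFin {zero}  f = 0ℤ
sumFin {suc r} f = f zero + sumFin (λ j → f (suc j))

_+ᵥ_ : ∀ {m} → Vecℤ m → Vecℤ m → Vecℤ m
(x +ᵥ y) i = x i + y i

_-ᵥ_ : ∀ {m} → Vecℤ m → Vecℤ m → Vecℤ m
(x -ᵥ y) i = x i - y i

_·ᵥ_ : ∀ {m r} → Mat m r → Vecℤ r → Vecℤ m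
(M ·ᵥ c) i = sumFin (λ j → M i j * c j)

e : ∀ {m} → Fin m → Vecℤ m
e i k with i ≟ k
... | yes _ = 1ℤ
... | no  _ = 0ℤ

-- The standardized abelian Cayley graph X_M = Cay(ℤ^m / H, S),
-- H = column span of M.  Vertices are represented by elements of ℤ^m;
-- two representatives denote the same vertex iff their difference lies in H.

InH : ∀ {m r} → Mat m r → Vecℤ m → Set
InH M v = ∃[ c ] (∀ i → v i ≡ (M ·ᵥ c) i)

SameVertex : ∀ {m r} → Mat m r → Vecℤ m → Vecℤ m → Set
SameVertex M x y = InH M (x -ᵥ y)

Adj : ∀ {m r} → Mat m r → Vecℤ m → Vecℤ m → Set
Adj M x y = ∃[ i ] (InH M ((x -ᵥ y) -ᵥ e i) ⊎ InH M ((x -ᵥ y) +ᵥ e i))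

-- Group homomorphisms ℤ^m → ℤ^n given by the images of the generators,
-- f i = image of e_i; extended linearly: x ↦ Σ_i x_i f(e_i).

Images : ℕ → ℕ → Set
Images m n = Fin m → Vecℤ n

apply : ∀ {m n} → Images m n → Vecℤ m → Vecℤ n
apply f x k = sumFin (λ i → x i * f i k)

-- composite (first f, then g)
compose : ∀ {m n p} → Images m n → Images n p → Images m p
compose f g i = apply g (f i)

idImg : ∀ {m} → Images m m
idImg i = e i

-- The map induced by f is a well-defined map of vertex sets
-- ℤ^m/H_A → ℤ^n/H_B and a graph homomorphism X_A → X_B.
IsGraphHom : ∀ {m r n s} → Mat m r → Mat n s → Images m n → Set
IsGraphHom A B f =
  (∀ x y → SameVertex A x y → SameVertex B (apply f x) (apply f y)) ×
  (∀ x y → Adj A x y → Adj B (apply f x) (apply f y))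

scaleCol : ∀ {m r} → Mat m r → Fin r → ℤ → Mat m r
scaleCol M j a i k with j ≟ k
... | yes _ = a * M i k
... | no  _ = M i k

snoc : ∀ {r} {A : Set} → (Fin r → A) → A → Fin (suc r) → A
snoc {zero}  f a zero    = a
snoc {suc r} f a zero    = f zero
snoc {suc r} f a (suc j) = snoc (λ k → f (suc k)) a j

appendCol : ∀ {m r} → Mat m r → Vecℤ m → Mat m (suc r)
appendCol M y i = snoc (M i) (y i)

appendZeroRow : ∀ {m r} → Mat m r → Mat (suc m) r
appendZeroRow M = snoc M (λ _ → 0ℤ)

mergeRows : ∀ {m r} → Mat (suc (suc m)) r → Mat (suc m) r
mergeRows M zero    k = M zero k + M (suc zero) k
mergeRows M (suc i) k = M (suc (suc i)) k

mergeImg : ∀ {m} → Images (suc (suc m)) (suc m)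
mergeImg zero          = e zero
mergeImg (suc zero)    = e zero
mergeImg (suc (suc i)) = e (suc i)

embedImg : ∀ {m} → Images m (suc m)
embedImg i = e (inject₁ i)

permCols : ∀ {m r} → Mat m r → Permutation′ r → Mat m r
permCols M σ i j = M i (σ ⟨$⟩ʳ j)

addColMul : ∀ {m r} → Mat m r → Fin r → Fin r → ℤ → Mat m r
addColMul M j k a i l with j ≟ l
... | yes _ = M i l + a * M i k
... | no  _ = M i l

deleteCol : ∀ {m r} → Mat m (suc r) → Fin (suc r) → Mat m r
deleteCol M j i k = M i (punchIn j k)

ColInSpanOfOthers : ∀ {m r} → Mat m (suc r) → Fin (suc r) → Set
ColInSpanOfOthers M j = InH (deleteCol M j) (λ i → M i j)

-- permute rows: row i of M becomes row σ(i)
permRows : ∀ {m r} → Mat m r → Permutation′ m → Mat m r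
permRows M σ k j = M (σ ⟨$⟩ˡ k) j

permRowsImg : ∀ {m} → Permutation′ m → Images m m
permRowsImg σ i = e (σ ⟨$⟩ʳ i)

negRow : ∀ {m r} → Mat m r → Fin m → Mat m r
negRow M i₀ i k with i₀ ≟ i
... | yes _ = - M i k
... | no  _ = M i k

negRowImg : ∀ {m} → Fin m → Images m m
negRowImg i₀ i k with i₀ ≟ i
... | yes _ = - e i k
... | no  _ = e i k

PartA : Set
PartA = ∀ {m r} (M : Mat m r) (a : ℤ) (j : Fin r) →
  IsGraphHom (scaleCol M j a) M idImg

PartB : Set
PartB = ∀ {m r} (M : Mat (suc (suc m)) r) →
  IsGraphHom M (mergeRows M) mergeImg

PartC : Set
PartC = ∀ {m r} (M : Mat m r) (y : Vecℤ m) →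
  IsGraphHom M (appendCol M y) idImg

PartD : Set
PartD = ∀ {m r} (M : Mat m r) →
  IsGraphHom M (appendZeroRow M) embedImg

PartE : Set
PartE =
  (∀ {m r} (M : Mat m r) (σ : Permutation′ r) →
     IsGraphHom M (permCols M σ) idImg) ×
  (∀ {m r} (M : Mat m r) (j : Fin r) →
     IsGraphHom M (scaleCol M j (- 1ℤ)) idImg) ×
  (∀ {m r} (M : Mat m r) (j k : Fin r) (a : ℤ) → j ≢ k →
     IsGraphHom M (addColMul M j k a) idImg) ×
  (∀ {m r} (M : Mat m (suc r)) (j : Fin (suc r)) → ColInSpanOfOthers M j →
     IsGraphHom M (deleteCol M j) idImg × IsGraphHom (deleteCol M j) M idImg) ×
  (∀ {m r} (M : Mat m r) (σ : Permutation′ m) →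
     IsGraphHom M (permRows M σ) (permRowsImg σ)) ×
  (∀ {m r} (M : Mat m r) (i₀ : Fin m) →
     IsGraphHom M (negRow M i₀) (negRowImg i₀)) ×
  (∀ {m r n s p t} (A : Mat m r) (B : Mat n s) (C : Mat p t)
     (f : Images m n) (g : Images n p) →
     IsGraphHom A B f → IsGraphHom B C g → IsGraphHom A C (compose f g))

-- A map f : ℤ^m → ℤ^n, given by the images of the generators, induces a graph
-- homomorphism X_A → X_B as soon as (i) f sends every column of A into the
-- column span H_B of B and (ii) every f(e_i) is some ±e_j.  By linearity (i)
-- gives f(H_A) ⊆ H_B, so f is well defined on cosets, and then x − y ∈ H_A ± e_i
-- yields f x − f y ∈ H_B ± f(e_i) = H_B ± e_j.
-- All maps of the lemma satisfy (ii) by construction.  For (i), either f A is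
-- B itself (part b, part d and the row operations), or f = id and every column
-- of A is an integer combination of columns of B; for the invertible column
-- operations this is read off from the inverse operation, whose columns are
-- visibly such combinations.
module Submission where

open import Data.Nat using (zero; suc)
open import Data.Integer using (ℤ; _+_; _*_; -_; _-_; 0ℤ; 1ℤ; -1ℤ)
open import Data.Integer.Properties
  using (+-*-semiring; *-comm; *-assoc; *-zeroʳ; *-identityˡ; *-identityʳ;
         +-identityˡ; +-identityʳ; *-distribˡ-+; *-distribʳ-+;
         neg-involutive; neg-distribˡ-*; -1*i≡-i)
open import Data.Integer.Solver using (module +-*-Solver)
open import Algebra.Properties.Semiring.Sum +-*-semiring
  using (sum; sum-cong-≗; sum-replicate-zero; ∑-distrib-+; ∑-comm;
         *-distribˡ-sum; *-distribʳ-sum)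
open import Data.Fin using (Fin; zero; suc; inject₁; punchIn; punchOut; _≟_)
open import Data.Fin.Properties using (suc-injective; punchIn-punchOut)
open import Data.Fin.Permutation
  using (Permutation′; _⟨$⟩ʳ_; _⟨$⟩ˡ_; inverseˡ; inverseʳ)
open import Data.Product using (_×_; _,_; ∃-syntax)
open import Data.Sum using (_⊎_; inj₁; inj₂)
open import Data.Empty using (⊥-elim)
open import Function using (_∘_)
open import Relation.Binary.PropositionalEquality
open import Relation.Nullary using (yes; no)

open import Defs

open +-*-Solver
open ≡-Reasoning

sumFin≡sum : ∀ {r} (f : Fin r → ℤ) → sumFin f ≡ sum f
sumFin≡sum {zero}  f = refl
sumFin≡sum {suc r} f = cong (f zero +_) (sumFin≡sum (f ∘ suc))

sumFin-cong : ∀ {r} {f g : Fin r → ℤ} → f ≗ g → sumFin f ≡ sumFin g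
sumFin-cong {f = f} {g} f≗g
  rewrite sumFin≡sum f | sumFin≡sum g = sum-cong-≗ f≗g

sumFin-zero : ∀ r → sumFin {r} (λ _ → 0ℤ) ≡ 0ℤ
sumFin-zero r = trans (sumFin≡sum {r} (λ _ → 0ℤ)) (sum-replicate-zero r)

sumFin-+ : ∀ {r} (f g : Fin r → ℤ) →
           sumFin (λ i → f i + g i) ≡ sumFin f + sumFin g
sumFin-+ f g rewrite sumFin≡sum (λ i → f i + g i) | sumFin≡sum f | sumFin≡sum g =
  ∑-distrib-+ f g

sumFin-*ˡ : ∀ {r} a (f : Fin r → ℤ) → sumFin (λ i → a * f i) ≡ a * sumFin f
sumFin-*ˡ a f rewrite sumFin≡sum (λ i → a * f i) | sumFin≡sum f =
  sym (*-distribˡ-sum a f)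

sumFin-*ʳ : ∀ {r} a (f : Fin r → ℤ) → sumFin (λ i → f i * a) ≡ sumFin f * a
sumFin-*ʳ a f rewrite sumFin≡sum (λ i → f i * a) | sumFin≡sum f =
  sym (*-distribʳ-sum a f)

sumFin-neg : ∀ {r} (f : Fin r → ℤ) → sumFin (λ i → - f i) ≡ - sumFin f
sumFin-neg f = begin
  sumFin (λ i → - f i)      ≡⟨ sumFin-cong (sym ∘ -1*i≡-i ∘ f) ⟩
  sumFin (λ i → -1ℤ * f i)  ≡⟨ sumFin-*ˡ -1ℤ f ⟩
  -1ℤ * sumFin f            ≡⟨ -1*i≡-i _ ⟩
  - sumFin f                ∎

sumFin-comm : ∀ {m n} (G : Fin m → Fin n → ℤ) →
              sumFin (λ i → sumFin (G i)) ≡ sumFin (λ j → sumFin (λ i → G i j))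
sumFin-comm G = begin
  sumFin (λ i → sumFin (G i))            ≡⟨ sumFin≡sum (λ i → sumFin (G i)) ⟩
  sum (λ i → sumFin (G i))               ≡⟨ sum-cong-≗ (sumFin≡sum ∘ G) ⟩
  sum (λ i → sum (G i))                  ≡⟨ ∑-comm G ⟩
  sum (λ j → sum (λ i → G i j))          ≡⟨ sum-cong-≗ (λ j → sym (sumFin≡sum (λ i → G i j))) ⟩
  sum (λ j → sumFin (λ i → G i j))       ≡⟨ sumFin≡sum (λ j → sumFin (λ i → G i j)) ⟨
  sumFin (λ j → sumFin (λ i → G i j))    ∎

e-resp-⇔ : ∀ {m n} {i k : Fin m} {i′ k′ : Fin n} →
           (i ≡ k → i′ ≡ k′) → (i′ ≡ k′ → i ≡ k) → e i k ≡ e i′ k′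
e-resp-⇔ {i = i} {k} {i′} {k′} to from with i ≟ k | i′ ≟ k′
... | yes _   | yes _    = refl
... | no _    | no _     = refl
... | yes i≡k | no i′≢k′ = ⊥-elim (i′≢k′ (to i≡k))
... | no i≢k  | yes i′≡k′ = ⊥-elim (i≢k (from i′≡k′))

e-comm : ∀ {m} (i k : Fin m) → e i k ≡ e k i
e-comm i k = e-resp-⇔ sym sym

e-suc : ∀ {m} (i k : Fin m) → e (suc i) (suc k) ≡ e i k
e-suc i k = e-resp-⇔ suc-injective (cong suc)

e-permute : ∀ {m} (σ : Permutation′ m) i k → e (σ ⟨$⟩ʳ i) k ≡ e i (σ ⟨$⟩ˡ k)
e-permute σ i k = e-resp-⇔ (λ σi≡k → trans (sym (inverseˡ σ)) (cong (σ ⟨$⟩ˡ_) σi≡k))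
                           (λ i≡σ⁻¹k → trans (cong (σ ⟨$⟩ʳ_) i≡σ⁻¹k) (inverseʳ σ))

sumFin-*e : ∀ {m} (g : Fin m → ℤ) k → sumFin (λ i → g i * e i k) ≡ g k
sumFin-*e {suc m} g zero = begin
  g zero * 1ℤ + sumFin (λ i → g (suc i) * 0ℤ)  ≡⟨ cong₂ _+_ (*-identityʳ (g zero)) (sumFin-cong {m} (*-zeroʳ ∘ g ∘ suc)) ⟩
  g zero + sumFin {m} (λ _ → 0ℤ)               ≡⟨ cong (g zero +_) (sumFin-zero m) ⟩
  g zero + 0ℤ                                  ≡⟨ +-identityʳ _ ⟩
  g zero                                       ∎
sumFin-*e {suc m} g (suc k) = begin
  g zero * 0ℤ + sumFin (λ i → g (suc i) * e (suc i) (suc k))  ≡⟨ cong₂ _+_ (*-zeroʳ (g zero)) (sumFin-cong (λ i → cong (g (suc i) *_) (e-suc i k))) ⟩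
  0ℤ + sumFin (λ i → g (suc i) * e i k)                       ≡⟨ +-identityˡ _ ⟩
  sumFin (λ i → g (suc i) * e i k)                            ≡⟨ sumFin-*e (g ∘ suc) k ⟩
  g (suc k)                                                   ∎

sumFin-*e′ : ∀ {m} (g : Fin m → ℤ) k → sumFin (λ i → g i * e k i) ≡ g k
sumFin-*e′ g k = trans (sumFin-cong (λ i → cong (g i *_) (e-comm k i))) (sumFin-*e g k)

column : ∀ {m r} → Mat m r → Fin r → Vecℤ m
column A l i = A i l

module _ {m n} (f : Images m n) where

  apply-cong : ∀ {x y} → x ≗ y → apply f x ≗ apply f y
  apply-cong x≗y k = sumFin-cong (λ i → cong (_* f i k) (x≗y i))

  apply-+ : ∀ x y → apply f (x +ᵥ y) ≗ apply f x +ᵥ apply f y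
  apply-+ x y k = trans (sumFin-cong (λ i → *-distribʳ-+ (f i k) (x i) (y i))) (sumFin-+ (λ i → x i * f i k) (λ i → y i * f i k))

  apply-− : ∀ x y → apply f (x -ᵥ y) ≗ apply f x -ᵥ apply f y
  apply-− x y k = begin
    apply f (x -ᵥ y) k                                ≡⟨ apply-+ x (-_ ∘ y) k ⟩
    apply f x k + sumFin (λ i → - y i * f i k)        ≡⟨ cong (apply f x k +_) (sumFin-cong (λ i → sym (neg-distribˡ-* (y i) (f i k)))) ⟩
    apply f x k + sumFin (λ i → - (y i * f i k))      ≡⟨ cong (apply f x k +_) (sumFin-neg (λ i → y i * f i k)) ⟩
    apply f x k - apply f y k                         ∎

  apply-e : ∀ i → apply f (e i) ≗ f i
  apply-e i k = trans (sumFin-cong (λ l → *-comm (e i l) (f l k))) (sumFin-*e′ (λ l → f l k) i)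

  apply-·ᵥ : ∀ {r} (A : Mat m r) c →
             apply f (A ·ᵥ c) ≗ (λ k l → apply f (column A l) k) ·ᵥ c
  apply-·ᵥ A c k = begin
    sumFin (λ i → sumFin (λ l → A i l * c l) * f i k)         ≡⟨ sumFin-cong (λ i → sym (sumFin-*ʳ (f i k) (λ l → A i l * c l))) ⟩
    sumFin (λ i → sumFin (λ l → A i l * c l * f i k))         ≡⟨ sumFin-comm (λ i l → A i l * c l * f i k) ⟩
    sumFin (λ l → sumFin (λ i → A i l * c l * f i k))         ≡⟨ sumFin-cong (λ l → sumFin-cong (λ i → swap (A i l) (c l) (f i k))) ⟩
    sumFin (λ l → sumFin (λ i → A i l * f i k * c l))         ≡⟨ sumFin-cong (λ l → sumFin-*ʳ (c l) (λ i → A i l * f i k)) ⟩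
    sumFin (λ l → sumFin (λ i → A i l * f i k) * c l)         ∎
    where
    swap : ∀ a b x → a * b * x ≡ a * x * b
    swap = solve 3 (λ a b x → a :* b :* x := a :* x :* b) refl

apply-idImg : ∀ {m} (x : Vecℤ m) → apply idImg x ≗ x
apply-idImg = sumFin-*e

apply-compose : ∀ {m n p} (f : Images m n) (g : Images n p) x →
                apply (compose f g) x ≗ apply g (apply f x)
apply-compose f g x k = begin
  sumFin (λ i → x i * sumFin (λ j → f i j * g j k))     ≡⟨ sumFin-cong (λ i → sym (sumFin-*ˡ (x i) (λ j → f i j * g j k))) ⟩
  sumFin (λ i → sumFin (λ j → x i * (f i j * g j k)))   ≡⟨ sumFin-comm (λ i j → x i * (f i j * g j k)) ⟩
  sumFin (λ j → sumFin (λ i → x i * (f i j * g j k)))   ≡⟨ sumFin-cong (λ j → sumFin-cong (λ i → sym (*-assoc (x i) (f i j) (g j k)))) ⟩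
  sumFin (λ j → sumFin (λ i → x i * f i j * g j k))     ≡⟨ sumFin-cong (λ j → sumFin-*ʳ (g j k) (λ i → x i * f i j)) ⟩
  sumFin (λ j → sumFin (λ i → x i * f i j) * g j k)     ∎

module _ {m r} (B : Mat m r) where

  InH-resp : ∀ {u v} → u ≗ v → InH B u → InH B v
  InH-resp u≗v (c , u≡Bc) = c , λ i → trans (sym (u≗v i)) (u≡Bc i)

  InH-zero : InH B (λ _ → 0ℤ)
  InH-zero = (λ _ → 0ℤ) , λ i → sym (trans (sumFin-cong (*-zeroʳ ∘ B i)) (sumFin-zero r))

  InH-+ : ∀ {u v} → InH B u → InH B v → InH B (u +ᵥ v)
  InH-+ {u} {v} (c , u≡Bc) (d , v≡Bd) = (c +ᵥ d) , λ i → begin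
    u i + v i                                               ≡⟨ cong₂ _+_ (u≡Bc i) (v≡Bd i) ⟩
    sumFin (λ j → B i j * c j) + sumFin (λ j → B i j * d j) ≡⟨ sumFin-+ (λ j → B i j * c j) (λ j → B i j * d j) ⟨
    sumFin (λ j → B i j * c j + B i j * d j)                ≡⟨ sumFin-cong (λ j → *-distribˡ-+ (B i j) (c j) (d j)) ⟨
    (B ·ᵥ (c +ᵥ d)) i                                     ∎

  InH-* : ∀ {u} a → InH B u → InH B (λ i → a * u i)
  InH-* {u} a (c , u≡Bc) = (λ j → a * c j) , λ i → begin
    a * u i                                   ≡⟨ cong (a *_) (u≡Bc i) ⟩
    a * sumFin (λ j → B i j * c j)            ≡⟨ sumFin-*ˡ a (λ j → B i j * c j) ⟨
    sumFin (λ j → a * (B i j * c j))          ≡⟨ sumFin-cong (λ j → pull (B i j) (c j)) ⟩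
    (B ·ᵥ (λ j → a * c j)) i                  ∎
    where
    pull : ∀ x y → a * (x * y) ≡ x * (a * y)
    pull x y = solve 3 (λ a x y → a :* (x :* y) := x :* (a :* y)) refl a x y

  InH-column : ∀ l → InH B (column B l)
  InH-column l = e l , λ i → sym (sumFin-*e′ (B i) l)

  InH-·ᵥ : ∀ {s} (A : Mat m s) → (∀ l → InH B (column A l)) → ∀ c → InH B (A ·ᵥ c)
  InH-·ᵥ {zero}  A columns c = InH-zero
  InH-·ᵥ {suc s} A columns c =
    InH-resp (λ i → cong (_+ (A′ ·ᵥ (c ∘ suc)) i) (*-comm (c zero) (A i zero)))
      (InH-+ {λ i → c zero * A i zero} {A′ ·ᵥ (c ∘ suc)}
             (InH-* (c zero) (columns zero))
             (InH-·ᵥ A′ (columns ∘ suc) (c ∘ suc)))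
    where
    A′ : Mat m s
    A′ i j = A i (suc j)

InH-apply : ∀ {m r n s} (A : Mat m r) (B : Mat n s) (f : Images m n) →
            (∀ l → InH B (apply f (column A l))) →
            ∀ {v} → InH A v → InH B (apply f v)
InH-apply A B f columns (c , v≡Ac) =
  InH-resp B (λ k → sym (trans (apply-cong f v≡Ac k) (apply-·ᵥ f A c k)))
    (InH-·ᵥ B _ columns c)

SignedBasisVector : ∀ {n} → Vecℤ n → Set
SignedBasisVector v = ∃[ j ] (v ≗ e j ⊎ v ≗ (-_ ∘ e j))

adjacent-by-signed : ∀ {n s} (B : Mat n s) {d v : Vecℤ n} → SignedBasisVector v →
                     InH B (d -ᵥ v) ⊎ InH B (d +ᵥ v) →
                     ∃[ j ] (InH B (d -ᵥ e j) ⊎ InH B (d +ᵥ e j))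
adjacent-by-signed B {d} (j , inj₁ v≗e) (inj₁ p) =
  j , inj₁ (InH-resp B (λ k → cong (_-_ (d k)) (v≗e k)) p)
adjacent-by-signed B {d} (j , inj₁ v≗e) (inj₂ p) =
  j , inj₂ (InH-resp B (λ k → cong (d k +_) (v≗e k)) p)
adjacent-by-signed B {d} (j , inj₂ v≗-e) (inj₁ p) =
  j , inj₂ (InH-resp B (λ k → trans (cong (_-_ (d k)) (v≗-e k)) (cong (d k +_) (neg-involutive (e j k)))) p)
adjacent-by-signed B {d} (j , inj₂ v≗-e) (inj₂ p) =
  j , inj₁ (InH-resp B (λ k → cong (d k +_) (v≗-e k)) p)

signed-basis-graphHom : ∀ {m r n s} (A : Mat m r) (B : Mat n s) (f : Images m n) →
                        (∀ l → InH B (apply f (column A l))) →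
                        (∀ i → SignedBasisVector (f i)) → IsGraphHom A B f
signed-basis-graphHom A B f columns signed = sameVertex , adjacent
  where
  image : ∀ {v} → InH A v → InH B (apply f v)
  image = InH-apply A B f columns

  sameVertex : ∀ x y → SameVertex A x y → SameVertex B (apply f x) (apply f y)
  sameVertex x y p = InH-resp B (apply-− f x y) (image p)

  image-offset : ∀ (_∙_ : ℤ → ℤ → ℤ) →
                 (∀ u v → apply f (λ k → u k ∙ v k) ≗ (λ k → apply f u k ∙ apply f v k)) →
                 ∀ x y i → InH A (λ k → (x -ᵥ y) k ∙ e i k) →
                 InH B (λ k → (apply f x -ᵥ apply f y) k ∙ f i k)
  image-offset _∙_ apply-∙ x y i p = InH-resp B
    (λ k → trans (apply-∙ (x -ᵥ y) (e i) k) (cong₂ _∙_ (apply-− f x y k) (apply-e f i k)))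
    (image p)

  adjacent : ∀ x y → Adj A x y → Adj B (apply f x) (apply f y)
  adjacent x y (i , inj₁ p) = adjacent-by-signed B {apply f x -ᵥ apply f y} (signed i)
                                (inj₁ (image-offset _-_ (apply-− f) x y i p))
  adjacent x y (i , inj₂ p) = adjacent-by-signed B {apply f x -ᵥ apply f y} (signed i)
                                (inj₂ (image-offset _+_ (apply-+ f) x y i p))

columnwise-graphHom : ∀ {m r n} (A : Mat m r) (B : Mat n r) (f : Images m n) →
                      (∀ l → apply f (column A l) ≗ column B l) →
                      (∀ i → SignedBasisVector (f i)) → IsGraphHom A B f
columnwise-graphHom A B f fA≡B =
  signed-basis-graphHom A B f (λ l → InH-resp B (sym ∘ fA≡B l) (InH-column B l))

idImg-graphHom : ∀ {m r s} (A : Mat m r) (B : Mat m s) →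
                 (∀ l → InH B (column A l)) → IsGraphHom A B idImg
idImg-graphHom A B columns =
  signed-basis-graphHom A B idImg
    (λ l → InH-resp B (sym ∘ apply-idImg (column A l)) (columns l))
    (λ i → i , inj₁ (λ _ → refl))

compose-graphHom : ∀ {m r n s p t} (A : Mat m r) (B : Mat n s) (C : Mat p t)
                   (f : Images m n) (g : Images n p) →
                   IsGraphHom A B f → IsGraphHom B C g → IsGraphHom A C (compose f g)
compose-graphHom A B C f g (sameᶠ , adjᶠ) (sameᵍ , adjᵍ) = sameVertex , adjacent
  where
  g∘f-− : ∀ x y → (apply g (apply f x) -ᵥ apply g (apply f y)) ≗ (apply (compose f g) x -ᵥ apply (compose f g) y)
  g∘f-− x y k = sym (cong₂ _-_ (apply-compose f g x k) (apply-compose f g y k))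

  sameVertex : ∀ x y → SameVertex A x y → SameVertex C (apply (compose f g) x) (apply (compose f g) y)
  sameVertex x y p = InH-resp C (g∘f-− x y) (sameᵍ (apply f x) (apply f y) (sameᶠ x y p))

  adjacent : ∀ x y → Adj A x y → Adj C (apply (compose f g) x) (apply (compose f g) y)
  adjacent x y p with adjᵍ (apply f x) (apply f y) (adjᶠ x y p)
  ... | j , inj₁ q = j , inj₁ (InH-resp C (λ k → cong (_- e j k) (g∘f-− x y k)) q)
  ... | j , inj₂ q = j , inj₂ (InH-resp C (λ k → cong (_+ e j k) (g∘f-− x y k)) q)

snoc-inject₁ : ∀ {r} {A : Set} (f : Fin r → A) a i → snoc f a (inject₁ i) ≡ f i
snoc-inject₁ {suc r} f a zero    = refl
snoc-inject₁ {suc r} f a (suc i) = snoc-inject₁ (f ∘ suc) a i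

snoc-∘ : ∀ {r} {A B : Set} (g : A → B) (f : Fin r → A) a k →
         g (snoc f a k) ≡ snoc (g ∘ f) (g a) k
snoc-∘ {zero}  g f a zero    = refl
snoc-∘ {suc r} g f a zero    = refl
snoc-∘ {suc r} g f a (suc k) = snoc-∘ g (f ∘ suc) a k

apply-mergeImg : ∀ {m r} (M : Mat (suc (suc m)) r) l →
                 apply mergeImg (column M l) ≗ column (mergeRows M) l
apply-mergeImg M l k =
  trans (factor (M zero l) (M (suc zero) l) (e zero k) _)
        (apply-idImg (column (mergeRows M) l) k)
  where
  factor : ∀ a b x s → a * x + (b * x + s) ≡ (a + b) * x + s
  factor = solve 4 (λ a b x s → a :* x :+ (b :* x :+ s) := (a :+ b) :* x :+ s) refl

mergeImg-signed : ∀ {m} (i : Fin (suc (suc m))) → SignedBasisVector (mergeImg i)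
mergeImg-signed zero          = zero , inj₁ (λ _ → refl)
mergeImg-signed (suc zero)    = zero , inj₁ (λ _ → refl)
mergeImg-signed (suc (suc i)) = suc i , inj₁ (λ _ → refl)

apply-embedImg : ∀ {m} (v : Vecℤ m) → apply embedImg v ≗ snoc v 0ℤ
apply-embedImg {zero}  v zero    = refl
apply-embedImg {suc m} v zero    = apply-idImg v zero
apply-embedImg {suc m} v (suc k) = begin
  v zero * 0ℤ + sumFin (λ i → v (suc i) * e (suc (inject₁ i)) (suc k))  ≡⟨ cong₂ _+_ (*-zeroʳ (v zero)) (sumFin-cong (λ i → cong (v (suc i) *_) (e-suc (inject₁ i) k))) ⟩
  0ℤ + apply embedImg (v ∘ suc) k                                        ≡⟨ +-identityˡ _ ⟩
  apply embedImg (v ∘ suc) k                                             ≡⟨ apply-embedImg (v ∘ suc) k ⟩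
  snoc (v ∘ suc) 0ℤ k                                                    ∎

apply-permRowsImg : ∀ {m} (σ : Permutation′ m) v k →
                    apply (permRowsImg σ) v k ≡ v (σ ⟨$⟩ˡ k)
apply-permRowsImg σ v k =
  trans (sumFin-cong (λ i → cong (v i *_) (e-permute σ i k))) (sumFin-*e v (σ ⟨$⟩ˡ k))

-- The diagonal ±1 matrix by which both negRow and negRowImg multiply.
rowSign : ∀ {m} → Fin m → Fin m → ℤ
rowSign i₀ i with i₀ ≟ i
... | yes _ = -1ℤ
... | no _  = 1ℤ

negRow≡rowSign* : ∀ {m r} (M : Mat m r) i₀ i l → negRow M i₀ i l ≡ rowSign i₀ i * M i l
negRow≡rowSign* M i₀ i l with i₀ ≟ i
... | yes _ = sym (-1*i≡-i (M i l))
... | no _  = sym (*-identityˡ (M i l))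

negRowImg≡rowSign* : ∀ {m} (i₀ i k : Fin m) → negRowImg i₀ i k ≡ rowSign i₀ i * e i k
negRowImg≡rowSign* i₀ i k with i₀ ≟ i
... | yes _ = sym (-1*i≡-i (e i k))
... | no _  = sym (*-identityˡ (e i k))

negRowImg-signed : ∀ {m} (i₀ i : Fin m) → SignedBasisVector (negRowImg i₀ i)
negRowImg-signed i₀ i with i₀ ≟ i
... | yes _ = i , inj₂ (λ _ → refl)
... | no _  = i , inj₁ (λ _ → refl)

apply-negRowImg : ∀ {m} (i₀ : Fin m) v k → apply (negRowImg i₀) v k ≡ rowSign i₀ k * v k
apply-negRowImg i₀ v k = begin
  sumFin (λ i → v i * negRowImg i₀ i k)          ≡⟨ sumFin-cong (λ i → cong (v i *_) (negRowImg≡rowSign* i₀ i k)) ⟩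
  sumFin (λ i → v i * (rowSign i₀ i * e i k))    ≡⟨ sumFin-cong (λ i → sym (*-assoc (v i) _ _)) ⟩
  sumFin (λ i → v i * rowSign i₀ i * e i k)      ≡⟨ sumFin-*e (λ i → v i * rowSign i₀ i) k ⟩
  v k * rowSign i₀ k                             ≡⟨ *-comm (v k) _ ⟩
  rowSign i₀ k * v k                             ∎

scaleCol-≡ : ∀ {m r} (M : Mat m r) {j l} a i → j ≡ l → scaleCol M j a i l ≡ a * M i l
scaleCol-≡ M {j} {l} a i j≡l with j ≟ l
... | yes _   = refl
... | no j≢l  = ⊥-elim (j≢l j≡l)

scaleCol-≢ : ∀ {m r} (M : Mat m r) {j l} a i → j ≢ l → scaleCol M j a i l ≡ M i l
scaleCol-≢ M {j} {l} a i j≢l with j ≟ l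
... | yes j≡l = ⊥-elim (j≢l j≡l)
... | no _    = refl

InH-scaleCol-column : ∀ {m r} (M : Mat m r) j a l → InH M (column (scaleCol M j a) l)
InH-scaleCol-column M j a l with j ≟ l
... | yes _ = InH-* M a (InH-column M l)
... | no _  = InH-column M l

scaleCol-by-−1-involutive : ∀ {m r} (M : Mat m r) j i l →
                           scaleCol (scaleCol M j -1ℤ) j -1ℤ i l ≡ M i l
scaleCol-by-−1-involutive M j i l with j ≟ l
... | yes j≡l = trans (cong (-1ℤ *_) (scaleCol-≡ M -1ℤ i j≡l))
                      (solve 1 (λ x → con -1ℤ :* (con -1ℤ :* x) := x) refl (M i l))
... | no j≢l  = scaleCol-≢ M -1ℤ i j≢l

addColMul-≡ : ∀ {m r} (M : Mat m r) {j l} k a i → j ≡ l → addColMul M j k a i l ≡ M i l + a * M i k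
addColMul-≡ M {j} {l} k a i j≡l with j ≟ l
... | yes _  = refl
... | no j≢l = ⊥-elim (j≢l j≡l)

addColMul-≢ : ∀ {m r} (M : Mat m r) {j l} k a i → j ≢ l → addColMul M j k a i l ≡ M i l
addColMul-≢ M {j} {l} k a i j≢l with j ≟ l
... | yes j≡l = ⊥-elim (j≢l j≡l)
... | no _    = refl

InH-addColMul-column : ∀ {m r} (M : Mat m r) j k a l → InH M (column (addColMul M j k a) l)
InH-addColMul-column M j k a l with j ≟ l
... | yes _ = InH-+ M (InH-column M l) (InH-* M a (InH-column M k))
... | no _  = InH-column M l

addColMul-inverse : ∀ {m r} (M : Mat m r) {j k} a → j ≢ k →
                    ∀ i l → addColMul (addColMul M j k a) j k (- a) i l ≡ M i l
addColMul-inverse M {j} {k} a j≢k i l with j ≟ l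
... | no j≢l  = addColMul-≢ M k a i j≢l
... | yes j≡l = begin
  addColMul M j k a i l + - a * addColMul M j k a i k  ≡⟨ cong₂ (λ x y → x + - a * y) (addColMul-≡ M k a i j≡l) (addColMul-≢ M k a i j≢k) ⟩
  M i l + a * M i k + - a * M i k                      ≡⟨ solve 3 (λ x y a → x :+ a :* y :+ :- a :* y := x) refl (M i l) (M i k) a ⟩
  M i l                                                ∎

scaleCol-graphHom : ∀ {m r} (M : Mat m r) (a : ℤ) (j : Fin r) →
                    IsGraphHom (scaleCol M j a) M idImg
scaleCol-graphHom M a j = idImg-graphHom (scaleCol M j a) M (InH-scaleCol-column M j a)

mergeRows-graphHom : ∀ {m r} (M : Mat (suc (suc m)) r) → IsGraphHom M (mergeRows M) mergeImg
mergeRows-graphHom M = columnwise-graphHom M (mergeRows M) mergeImg (apply-mergeImg M) mergeImg-signed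

appendCol-graphHom : ∀ {m r} (M : Mat m r) (y : Vecℤ m) → IsGraphHom M (appendCol M y) idImg
appendCol-graphHom M y = idImg-graphHom M N
  (λ l → InH-resp N (λ i → snoc-inject₁ (M i) (y i) l) (InH-column N (inject₁ l)))
  where
  N = appendCol M y

appendZeroRow-graphHom : ∀ {m r} (M : Mat m r) → IsGraphHom M (appendZeroRow M) embedImg
appendZeroRow-graphHom M = columnwise-graphHom M (appendZeroRow M) embedImg
  (λ l k → trans (apply-embedImg (column M l) k) (sym (snoc-∘ (λ row → row l) M (λ _ → 0ℤ) k)))
  (λ i → inject₁ i , inj₁ (λ _ → refl))

permCols-graphHom : ∀ {m r} (M : Mat m r) (σ : Permutation′ r) → IsGraphHom M (permCols M σ) idImg
permCols-graphHom M σ = idImg-graphHom M N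
  (λ l → InH-resp N (λ i → cong (M i) (inverseʳ σ)) (InH-column N (σ ⟨$⟩ˡ l)))
  where
  N = permCols M σ

negCol-graphHom : ∀ {m r} (M : Mat m r) (j : Fin r) → IsGraphHom M (scaleCol M j (- 1ℤ)) idImg
negCol-graphHom M j = idImg-graphHom M N
  (λ l → InH-resp N (λ i → scaleCol-by-−1-involutive M j i l) (InH-scaleCol-column N j -1ℤ l))
  where
  N = scaleCol M j -1ℤ

addColMul-graphHom : ∀ {m r} (M : Mat m r) (j k : Fin r) (a : ℤ) → j ≢ k →
                     IsGraphHom M (addColMul M j k a) idImg
addColMul-graphHom M j k a j≢k = idImg-graphHom M N
  (λ l → InH-resp N (λ i → addColMul-inverse M a j≢k i l) (InH-addColMul-column N j k (- a) l))
  where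
  N = addColMul M j k a

deleteCol-graphHom : ∀ {m r} (M : Mat m (suc r)) (j : Fin (suc r)) → ColInSpanOfOthers M j →
                     IsGraphHom M (deleteCol M j) idImg × IsGraphHom (deleteCol M j) M idImg
deleteCol-graphHom M j inSpan =
  idImg-graphHom M D columns , idImg-graphHom D M (InH-column M ∘ punchIn j)
  where
  D = deleteCol M j
  columns : ∀ l → InH D (column M l)
  columns l with j ≟ l
  ... | yes refl = inSpan
  ... | no j≢l   = InH-resp D (λ i → cong (M i) (punchIn-punchOut j≢l)) (InH-column D (punchOut j≢l))

permRows-graphHom : ∀ {m r} (M : Mat m r) (σ : Permutation′ m) →
                    IsGraphHom M (permRows M σ) (permRowsImg σ)
permRows-graphHom M σ = columnwise-graphHom M (permRows M σ) (permRowsImg σ)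
  (λ l → apply-permRowsImg σ (column M l))
  (λ i → σ ⟨$⟩ʳ i , inj₁ (λ _ → refl))

negRow-graphHom : ∀ {m r} (M : Mat m r) (i₀ : Fin m) → IsGraphHom M (negRow M i₀) (negRowImg i₀)
negRow-graphHom M i₀ = columnwise-graphHom M (negRow M i₀) (negRowImg i₀)
  (λ l k → trans (apply-negRowImg i₀ (column M l) k) (sym (negRow≡rowSign* M i₀ k l)))
  (negRowImg-signed i₀)

lemma2p10 : PartA × PartB × PartC × PartD × PartE
lemma2p10 =
  scaleCol-graphHom , mergeRows-graphHom , appendCol-graphHom , appendZeroRow-graphHom ,
  permCols-graphHom , negCol-graphHom , addColMul-graphHom , deleteCol-graphHom ,
  permRows-graphHom , negRow-graphHom , compose-graphHom
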